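{- For every simple graph $G$ of order $n\ge 2$ and every positive integer $t$, $\omega\big(S[G,t]\big)=\omega(G)$, where $\omega$ denotes the clique number.
   Context: Let $G$ be a simple graph with vertex set $V=\{1,\dots,n\}$, $n\ge 2$. For $t\ge 1$, the generalized Sierpiński graph $S(G,t)$ has vertex set $V^t$ (words $u_1u_2\cdots u_t$ over $V$), and two words ${\bf u}=u_1\cdots u_t$, ${\bf v}=v_1\cdots v_t$ are adjacent iff there is $i\in\{1,\dots,t\}$ with $u_j=v_j$ for $j<i$, $u_i\neq v_i$ and $u_iv_i\in E(G)$, and $u_j=v_i$, $v_j=u_i$ for all $j>i$. An edge of this kind with $i<t$ is called a linking edge; it joins $w\,ab\cdots b$ and $w\,ba\cdots a$ where $w$ is a word of length $r=i-1\le t-2$ and $ab\in E(G)$, and it is said to appear at step $t-r$. The generalized Sierpiński gasket $S[G,t]$ is the graph obtained from $S(G,t)$ by contracting all linking edges (so $S[G,1]=G$). -}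

module Defs where

open import Data.Nat using (ℕ; zero; suc; _≤_)
open import Data.Fin using (Fin)
open import Data.Vec using (Vec; []; _∷_; replicate)
open import Data.Product using (Σ; ∃; _×_; _,_)
open import Relation.Nullary using (¬_; Dec)
open import Relation.Binary.PropositionalEquality using (_≡_)
open import Relation.Binary.Construct.Closure.Equivalence using (EqClosure)

record SimpleGraph (n : ℕ) : Set₁ where
  field
    Adj    : Fin n → Fin n → Set
    sym    : ∀ {a b} → Adj a b → Adj b a
    irrefl : ∀ {a} → ¬ Adj a a
    dec    : ∀ a b → Dec (Adj a b)
open SimpleGraph public

Word : ℕ → ℕ → Set
Word n t = Vec (Fin n) t

-- Edges of the generalized Sierpiński graph S(G,t):
-- u = w a b…b , v = w b a…a with ab ∈ E(G), w a common prefix.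
data SAdj {n : ℕ} (G : SimpleGraph n) : {t : ℕ} → Word n t → Word n t → Set where
  here  : ∀ {m a b} → Adj G a b →
          SAdj G (a ∷ replicate m b) (b ∷ replicate m a)
  there : ∀ {t x} {u v : Word n t} → SAdj G u v → SAdj G (x ∷ u) (x ∷ v)

-- Linking edges: those edges of S(G,t) whose differing position i satisfies i < t,
-- i.e. at least one letter follows the first differing letter.
data Link {n : ℕ} (G : SimpleGraph n) : {t : ℕ} → Word n t → Word n t → Set where
  here  : ∀ {m a b} → Adj G a b →
          Link G (a ∷ replicate (suc m) b) (b ∷ replicate (suc m) a)
  there : ∀ {t x} {u v : Word n t} → Link G u v → Link G (x ∷ u) (x ∷ v)

-- A graph whose vertices are given up to an equivalence relation
-- (needed to represent the quotient obtained by edge contraction).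
record Graph : Set₁ where
  field
    V   : Set
    _≈_ : V → V → Set
    E   : V → V → Set

asGraph : ∀ {n} → SimpleGraph n → Graph
asGraph {n} G = record { V = Fin n ; _≈_ = _≡_ ; E = Adj G }

-- The generalized Sierpiński gasket S[G,t]: vertices of S(G,t) modulo the
-- equivalence generated by linking edges (contraction of all linking edges);
-- two classes are adjacent iff some representatives are adjacent in S(G,t).
gasket : ∀ {n} → SimpleGraph n → ℕ → Graph
gasket {n} G t = record
  { V   = Word n t
  ; _≈_ = EqClosure (Link G)
  ; E   = λ x y → Σ (Word n t) λ x' → Σ (Word n t) λ y' →
            EqClosure (Link G) x x' × EqClosure (Link G) y y' × SAdj G x' y'
  }

HasClique : Graph → ℕ → Set
HasClique H k = Σ (Fin k → V) λ f →
  ∀ i j → ¬ i ≡ j → (¬ (f i ≈ f j)) × E (f i) (f j)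
  where open Graph H

IsCliqueNumber : Graph → ℕ → Set
IsCliqueNumber H k = HasClique H k × (∀ m → HasClique H m → m ≤ k)

{-# OPTIONS --safe #-}
module Submission where

-- A word has at most one linking neighbour, so a vertex of S[G,t+1] (t ≥ 1) is either a single
-- word or a pair {x y…y, y x…x} with xy ∈ E(G): the first letters of its words form a set of one
-- or two letters, and two letters determine the vertex. An edge of S(G,t+1) that is not linking
-- keeps the first letter, so the first-letter sets of a clique pairwise intersect. Either they
-- share a letter x, and the clique comes from the copy x S[G,t] of the gasket one level down, or
-- they are the three sides of a triangle xyz of G, and sending each vertex to the opposite corner
-- is a clique of G of the same size. Conversely every copy of G in S(G,t) is a clique of S[G,t].

open import Defs
open import Data.Nat using (ℕ; zero; suc; _≤_; s≤s)
open import Data.Fin using (Fin; zero; _≟_)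
open import Data.Fin.Properties using (all?; ¬∀⟶∃¬)
open import Data.Vec using ([]; _∷_; replicate; head)
open import Data.Vec.Properties using (≡-dec)
open import Data.Product using (Σ; ∃; _×_; _,_; proj₁; proj₂)
open import Data.Sum using (_⊎_; inj₁; inj₂; map₂)
open import Data.Empty using (⊥-elim)
open import Function using (_∘_)
open import Function.Definitions using (Injective)
open import Relation.Nullary using (¬_; Dec; yes; no; contradiction)
open import Relation.Binary.PropositionalEquality as ≡ using (_≡_; _≢_; refl; cong)
open import Relation.Binary.Construct.Closure.Equivalence using (EqClosure; symmetric; return)
open import Relation.Binary.Construct.Closure.ReflexiveTransitive using (ε; _◅_; _◅◅_)
open import Relation.Binary.Construct.Closure.Symmetric using (fwd; bwd)

IsClique : (H : Graph) {m : ℕ} → (Fin m → Graph.V H) → Set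
IsClique H f = ∀ i j → i ≢ j → ¬ (f i ≈ f j) × E (f i) (f j)
  where open Graph H

sameCliques⇒sameCliqueNumber : (H H′ : Graph) →
  (∀ m → HasClique H m → HasClique H′ m) → (∀ m → HasClique H′ m → HasClique H m) →
  ∀ k → IsCliqueNumber H k → IsCliqueNumber H′ k
sameCliques⇒sameCliqueNumber _ _ to from k (clique , maximal) =
  to k clique , λ m clique′ → maximal m (from m clique′)

module PairwiseIntersecting {m : ℕ} {X : Set} (P : Fin (suc m) → X → Set)
  (P? : ∀ i x → Dec (P i x))
  (meet : ∀ i j → ∃ λ x → P i x × P j x)
  (atMostTwo : ∀ {i x y z} → P i x → P i y → P i z → x ≢ y → z ≡ x ⊎ z ≡ y)
  (pairDetermines : ∀ {i j x y} → P i x → P i y → P j x → P j y → x ≢ y → i ≡ j)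
  where

  Common : Set
  Common = ∃ λ x → ∀ i → P i x

  Labelling : Set
  Labelling = Σ (Fin (suc m) → X) λ lab →
    Injective _≡_ _≡_ lab × (∀ l l′ → ∃ λ h → P h (lab l) × P h (lab l′))

  record Triangle : Set where
    field
      x y z : X
      x≢y : x ≢ y
      y≢z : y ≢ z
      x≢z : x ≢ z
      i j k : Fin (suc m)
      Pix : P i x
      Piy : P i y
      Pjy : P j y
      Pjz : P j z
      Pkx : P k x
      Pkz : P k z

  everyOrMissing : ∀ x → (∀ i → P i x) ⊎ ∃ λ i → ¬ P i x
  everyOrMissing x with all? (λ i → P? i x)
  ... | yes every = inj₁ every
  ... | no ¬every = inj₂ (¬∀⟶∃¬ _ (λ i → P i x) (λ i → P? i x) ¬every)

  meetsAt : ∀ {l i u v} → P i u → P i v → u ≢ v → ¬ P l v → P l u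
  meetsAt {l} {i} Piu Piv u≢v ¬Plv with meet l i
  ... | w , Plw , Piw with atMostTwo Piu Piv Piw u≢v
  ...   | inj₁ refl = Plw
  ...   | inj₂ refl = contradiction Plw ¬Plv

  common⊎triangle : Common ⊎ Triangle
  common⊎triangle with meet zero zero
  ... | x , P₀x , _ with everyOrMissing x
  ...   | inj₁ every = inj₁ (x , every)
  ...   | inj₂ (j , ¬Pjx) with meet zero j
  ...     | y , P₀y , Pjy with everyOrMissing y
  ...       | inj₁ every = inj₁ (y , every)
  ...       | inj₂ (k , ¬Pky) with meet j k
  ...         | z , Pjz , Pkz = inj₂ (record
                  { x = x ; y = y ; z = z
                  ; x≢y = λ { refl → ¬Pjx Pjy }
                  ; y≢z = λ { refl → ¬Pky Pkz }
                  ; x≢z = λ { refl → ¬Pjx Pjz }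
                  ; i = zero ; j = j ; k = k
                  ; Pix = P₀x ; Piy = P₀y
                  ; Pjy = Pjy ; Pjz = Pjz
                  ; Pkx = meetsAt P₀x P₀y (λ { refl → ¬Pjx Pjy }) ¬Pky ; Pkz = Pkz
                  })

  module _ (T : Triangle) where
    open Triangle T

    data Side (l : Fin (suc m)) : Set where
      xy : P l x → P l y → Side l
      yz : P l y → P l z → Side l
      xz : P l x → P l z → Side l

    side : ∀ l → Side l
    side l with P? l z | P? l x
    ... | no ¬Plz | _       = xy (meetsAt Pkx Pkz x≢z ¬Plz) (meetsAt Pjy Pjz y≢z ¬Plz)
    ... | yes Plz | yes Plx = xz Plx Plz
    ... | yes Plz | no ¬Plx = yz (meetsAt Piy Pix (x≢y ∘ ≡.sym) ¬Plx) Plz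

    opposite : ∀ {l} → Side l → X
    opposite (xy _ _) = z
    opposite (yz _ _) = x
    opposite (xz _ _) = y

    opposite-injective : ∀ {l l′} (s : Side l) (s′ : Side l′) → opposite s ≡ opposite s′ → l ≡ l′
    opposite-injective (xy p q) (xy p′ q′) _ = pairDetermines p q p′ q′ x≢y
    opposite-injective (yz p q) (yz p′ q′) _ = pairDetermines p q p′ q′ y≢z
    opposite-injective (xz p q) (xz p′ q′) _ = pairDetermines p q p′ q′ x≢z
    opposite-injective (xy _ _) (yz _ _) e = ⊥-elim (x≢z (≡.sym e))
    opposite-injective (xy _ _) (xz _ _) e = ⊥-elim (y≢z (≡.sym e))
    opposite-injective (yz _ _) (xy _ _) e = ⊥-elim (x≢z e)
    opposite-injective (yz _ _) (xz _ _) e = ⊥-elim (x≢y e)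
    opposite-injective (xz _ _) (xy _ _) e = ⊥-elim (y≢z e)
    opposite-injective (xz _ _) (yz _ _) e = ⊥-elim (x≢y (≡.sym e))

    opposite-covered : ∀ {l l′} (s : Side l) (s′ : Side l′) →
                       ∃ λ h → P h (opposite s) × P h (opposite s′)
    opposite-covered (xy _ _) (xy _ _) = j , Pjz , Pjz
    opposite-covered (xy _ _) (yz _ _) = k , Pkz , Pkx
    opposite-covered (xy _ _) (xz _ _) = j , Pjz , Pjy
    opposite-covered (yz _ _) (xy _ _) = k , Pkx , Pkz
    opposite-covered (yz _ _) (yz _ _) = k , Pkx , Pkx
    opposite-covered (yz _ _) (xz _ _) = i , Pix , Piy
    opposite-covered (xz _ _) (xy _ _) = j , Pjy , Pjz
    opposite-covered (xz _ _) (yz _ _) = i , Piy , Pix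
    opposite-covered (xz _ _) (xz _ _) = i , Piy , Piy

    triangle⇒labelling : Labelling
    triangle⇒labelling =
      (λ l → opposite (side l)) ,
      (λ {l} {l′} → opposite-injective (side l) (side l′)) ,
      (λ l l′ → opposite-covered (side l) (side l′))

  common⊎labelling : Common ⊎ Labelling
  common⊎labelling = map₂ triangle⇒labelling common⊎triangle

module _ {n : ℕ} (G : SimpleGraph n) where

  infix 4 _≈_
  _≈_ : ∀ {t} → Word n t → Word n t → Set
  _≈_ = EqClosure (Link G)

  Edge : ∀ {t} → Word n t → Word n t → Set
  Edge {t} = Graph.E (gasket G t)

  Starts : ∀ {t} → Fin n → Word n (suc t) → Set
  Starts x w = ∃ λ u → (x ∷ u) ≈ w

  Link-sym : ∀ {t} {u v : Word n t} → Link G u v → Link G v u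
  Link-sym (here a~b) = here (sym G a~b)
  Link-sym (there l) = there (Link-sym l)

  Link-replicate : ∀ k b {v : Word n k} → ¬ Link G (replicate k b) v
  Link-replicate (suc k) b (here b~b) = irrefl G b~b
  Link-replicate (suc k) b (there l) = Link-replicate k b l

  Link-functional : ∀ {t} {u v w : Word n t} → Link G u v → Link G u w → v ≡ w
  Link-functional (here _) (here _) = refl
  Link-functional (here {m} _) (there l) = ⊥-elim (Link-replicate (suc m) _ l)
  Link-functional (there l) (here {m} _) = ⊥-elim (Link-replicate (suc m) _ l)
  Link-functional (there l) (there l′) = cong (_ ∷_) (Link-functional l l′)

  Link-∷⁻ : ∀ {t x} {u v : Word n t} → Link G (x ∷ u) (x ∷ v) → Link G u v
  Link-∷⁻ (here x~x) = ⊥-elim (irrefl G x~x)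
  Link-∷⁻ (there l) = l

  -- Link is symmetric and functional, so its equivalence closure adds nothing but reflexivity.
  ≈⇒≡⊎Link : ∀ {t} {u v : Word n t} → u ≈ v → u ≡ v ⊎ Link G u v
  ≈⇒≡⊎Link ε = inj₁ refl
  ≈⇒≡⊎Link (fwd l ◅ r) with ≈⇒≡⊎Link r
  ... | inj₁ refl = inj₂ l
  ... | inj₂ l′ = inj₁ (Link-functional (Link-sym l) l′)
  ≈⇒≡⊎Link (bwd l ◅ r) with ≈⇒≡⊎Link r
  ... | inj₁ refl = inj₂ (Link-sym l)
  ... | inj₂ l′ = inj₁ (Link-functional l l′)

  ≈₁⇒≡ : {u v : Word n 1} → u ≈ v → u ≡ v
  ≈₁⇒≡ p with ≈⇒≡⊎Link p
  ... | inj₁ u≡v = u≡v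
  ... | inj₂ (there ())

  ∷-cong-≈ : ∀ {t x} {u v : Word n t} → u ≈ v → (x ∷ u) ≈ (x ∷ v)
  ∷-cong-≈ p with ≈⇒≡⊎Link p
  ... | inj₁ refl = ε
  ... | inj₂ l = return (there l)

  ∷-cancel-≈ : ∀ {t x} {u v : Word n t} → (x ∷ u) ≈ (x ∷ v) → u ≈ v
  ∷-cancel-≈ p with ≈⇒≡⊎Link p
  ... | inj₁ refl = ε
  ... | inj₂ l = return (Link-∷⁻ l)

  ≈-distinct-heads : ∀ {t x y} {u v : Word n t} → (x ∷ u) ≈ (y ∷ v) → x ≢ y →
                     u ≡ replicate t y × v ≡ replicate t x × Adj G x y
  ≈-distinct-heads p x≢y with ≈⇒≡⊎Link p
  ... | inj₁ refl = ⊥-elim (x≢y refl)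
  ... | inj₂ (here x~y) = refl , refl , x~y
  ... | inj₂ (there _) = ⊥-elim (x≢y refl)

  SAdj-∷⁻ : ∀ {t a b} {u v : Word n (suc t)} → SAdj G (a ∷ u) (b ∷ v) →
            Link G (a ∷ u) (b ∷ v) ⊎ (a ≡ b × SAdj G u v)
  SAdj-∷⁻ (here a~b) = inj₁ (here a~b)
  SAdj-∷⁻ (there s) = inj₂ (refl , s)

  SAdj₁⇒Adj : ∀ {a b} → SAdj G (a ∷ []) (b ∷ []) → Adj G a b
  SAdj₁⇒Adj (here a~b) = a~b

  ≈-resp-Edge : ∀ {t} {u u′ v v′ : Word n t} → u′ ≈ u → v′ ≈ v → Edge u v → Edge u′ v′
  ≈-resp-Edge p q (u″ , v″ , u≈ , v≈ , s) = u″ , v″ , p ◅◅ u≈ , q ◅◅ v≈ , s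

  Edge-∷⁺ : ∀ {t x} {u v : Word n t} → Edge u v → Edge (x ∷ u) (x ∷ v)
  Edge-∷⁺ (_ , _ , u≈ , v≈ , s) = _ , _ , ∷-cong-≈ u≈ , ∷-cong-≈ v≈ , there s

  Edge-∷⁻ : ∀ {t x} {u v : Word n (suc t)} →
            Edge (x ∷ u) (x ∷ v) → ¬ (x ∷ u) ≈ (x ∷ v) → Edge u v
  Edge-∷⁻ {x = x} ((a ∷ p) , (b ∷ q) , u≈ , v≈ , s) ¬≈ with SAdj-∷⁻ s
  ... | inj₁ l = contradiction (u≈ ◅◅ return l ◅◅ symmetric _ v≈) ¬≈
  ... | inj₂ (refl , s′) with x ≟ a
  ...   | yes refl = p , q , ∷-cancel-≈ u≈ , ∷-cancel-≈ v≈ , s′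
  ...   | no x≢a with ≈-distinct-heads u≈ x≢a | ≈-distinct-heads v≈ x≢a
  ...     | refl , _ | refl , _ = contradiction ε ¬≈

  Edge⇒commonStart : ∀ {t} {u v : Word n (suc (suc t))} → Edge u v → ¬ u ≈ v →
                     ∃ λ x → Starts x u × Starts x v
  Edge⇒commonStart ((a ∷ p) , (b ∷ q) , u≈ , v≈ , s) ¬≈ with SAdj-∷⁻ s
  ... | inj₁ l = contradiction (u≈ ◅◅ return l ◅◅ symmetric _ v≈) ¬≈
  ... | inj₂ (refl , _) = a , (p , symmetric _ u≈) , (q , symmetric _ v≈)

  Starts-head : ∀ {t} (w : Word n (suc t)) → Starts (head w) w
  Starts-head (_ ∷ u) = u , ε

  Starts? : ∀ {t} x (w : Word n (suc (suc t))) → Dec (Starts x w)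
  Starts? x (c ∷ w) with x ≟ c
  ... | yes refl = yes (w , ε)
  ... | no x≢c with ≡-dec _≟_ w (replicate _ x) | dec G c x
  ...   | yes refl | yes c~x = yes (replicate _ c , return (here (sym G c~x)))
  ...   | yes _ | no ¬c~x = no λ (_ , p) → ¬c~x (sym G (proj₂ (proj₂ (≈-distinct-heads p x≢c))))
  ...   | no w≢xs | _ = no λ (_ , p) → w≢xs (proj₁ (proj₂ (≈-distinct-heads p x≢c)))

  Starts-adjacent : ∀ {t x y} {w : Word n (suc t)} → Starts x w → Starts y w → x ≢ y → Adj G x y
  Starts-adjacent (_ , p) (_ , q) x≢y = proj₂ (proj₂ (≈-distinct-heads (p ◅◅ symmetric _ q) x≢y))

  Starts-atMostTwo : ∀ {t x y z} {w : Word n (suc (suc t))} →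
                     Starts x w → Starts y w → Starts z w → x ≢ y → z ≡ x ⊎ z ≡ y
  Starts-atMostTwo {x = x} {z = z} (_ , p) (_ , q) (_ , r) x≢y with z ≟ x
  ... | yes z≡x = inj₁ z≡x
  ... | no z≢x with ≈-distinct-heads (p ◅◅ symmetric _ q) x≢y
                  | ≈-distinct-heads (p ◅◅ symmetric _ r) (z≢x ∘ ≡.sym)
  ...   | refl , _ | ys≡zs , _ = inj₂ (≡.sym (cong head ys≡zs))

  Starts-pair⇒≈ : ∀ {t x y} {w w′ : Word n (suc t)} →
                  Starts x w → Starts y w → Starts x w′ → Starts y w′ → x ≢ y → w ≈ w′
  Starts-pair⇒≈ (_ , p) (_ , q) (_ , p′) (_ , q′) x≢y
    with ≈-distinct-heads (p ◅◅ symmetric _ q) x≢y | ≈-distinct-heads (p′ ◅◅ symmetric _ q′) x≢y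
  ... | refl , _ | refl , _ = symmetric _ p ◅◅ p′

  gasket₁⇒graph : ∀ {m} → HasClique (gasket G 1) m → HasClique (asGraph G) m
  gasket₁⇒graph (f , clique) = head ∘ f , λ i j i≢j → edge (f i) (f j) (clique i j i≢j)
    where
    edge : (u v : Word n 1) → ¬ u ≈ v × Edge u v → head u ≢ head v × Adj G (head u) (head v)
    edge (a ∷ []) (b ∷ []) (¬≈ , (_ ∷ []) , (_ ∷ []) , p , q , s) with ≈₁⇒≡ p | ≈₁⇒≡ q
    ... | refl | refl = (λ { refl → ¬≈ ε }) , SAdj₁⇒Adj s

  graph⇒gasket₁ : ∀ {m} → HasClique (asGraph G) m → HasClique (gasket G 1) m
  graph⇒gasket₁ (f , clique) = (λ i → f i ∷ []) , λ i j i≢j →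
    (λ p → proj₁ (clique i j i≢j) (cong head (≈₁⇒≡ p))) ,
    (_ , _ , ε , ε , here (proj₂ (clique i j i≢j)))

  ∷-clique : ∀ {t m} → Fin n → HasClique (gasket G t) m → HasClique (gasket G (suc t)) m
  ∷-clique x (f , clique) = (λ i → x ∷ f i) , λ i j i≢j →
    proj₁ (clique i j i≢j) ∘ ∷-cancel-≈ , Edge-∷⁺ (proj₂ (clique i j i≢j))

  graph⇒gasket : Fin n → ∀ t m → HasClique (asGraph G) m → HasClique (gasket G (suc t)) m
  graph⇒gasket x zero m = graph⇒gasket₁
  graph⇒gasket x (suc t) m = ∷-clique x ∘ graph⇒gasket x t m

  module CliqueStep {t m : ℕ} (f : Fin (suc m) → Word n (suc (suc t)))
                    (clique : IsClique (gasket G (suc (suc t))) f) where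

    FirstLetter : Fin (suc m) → Fin n → Set
    FirstLetter i x = Starts x (f i)

    FirstLetter? : ∀ i x → Dec (FirstLetter i x)
    FirstLetter? i x = Starts? x (f i)

    meet : ∀ i j → ∃ λ x → FirstLetter i x × FirstLetter j x
    meet i j with i ≟ j
    ... | yes refl = head (f i) , Starts-head (f i) , Starts-head (f i)
    ... | no i≢j = Edge⇒commonStart (proj₂ (clique i j i≢j)) (proj₁ (clique i j i≢j))

    pairDetermines : ∀ {i j x y} → FirstLetter i x → FirstLetter i y →
                     FirstLetter j x → FirstLetter j y → x ≢ y → i ≡ j
    pairDetermines {i} {j} ix iy jx jy x≢y with i ≟ j
    ... | yes i≡j = i≡j
    ... | no i≢j = contradiction (Starts-pair⇒≈ ix iy jx jy x≢y) (proj₁ (clique i j i≢j))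

    open PairwiseIntersecting FirstLetter FirstLetter? meet Starts-atMostTwo pairDetermines

    tailClique : Common → HasClique (gasket G (suc t)) (suc m)
    tailClique (x , starts) = tail′ , λ i j i≢j →
      let ¬∷≈ = proj₁ (clique i j i≢j) ∘ ∷≈⇒≈ i j
      in ¬∷≈ ∘ ∷-cong-≈ ,
         Edge-∷⁻ (≈-resp-Edge (proj₂ (starts i)) (proj₂ (starts j)) (proj₂ (clique i j i≢j))) ¬∷≈
      where
      tail′ : Fin (suc m) → Word n (suc t)
      tail′ i = proj₁ (starts i)
      ∷≈⇒≈ : ∀ i j → (x ∷ tail′ i) ≈ (x ∷ tail′ j) → f i ≈ f j
      ∷≈⇒≈ i j p = symmetric _ (proj₂ (starts i)) ◅◅ p ◅◅ proj₂ (starts j)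

    labellingClique : Labelling → HasClique (asGraph G) (suc m)
    labellingClique (lab , injective , covered) = lab , λ l l′ l≢l′ →
      let lab≢ = l≢l′ ∘ injective
          (_ , hl , hl′) = covered l l′
      in lab≢ , Starts-adjacent hl hl′ lab≢

    step : HasClique (gasket G (suc t)) (suc m) ⊎ HasClique (asGraph G) (suc m)
    step with common⊎labelling
    ... | inj₁ common = inj₁ (tailClique common)
    ... | inj₂ labelling = inj₂ (labellingClique labelling)

  gasket⇒graph : ∀ t m → HasClique (gasket G (suc t)) m → HasClique (asGraph G) m
  gasket⇒graph zero m = gasket₁⇒graph
  gasket⇒graph (suc t) zero _ = (λ ()) , λ ()
  gasket⇒graph (suc t) (suc m) (f , clique) with CliqueStep.step f clique
  ... | inj₁ lower = gasket⇒graph t (suc m) lower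
  ... | inj₂ inG = inG

mainTheorem1 : (n : ℕ) → 2 ≤ n → (G : SimpleGraph n) → (t : ℕ) → 1 ≤ t →
    ∀ k → (IsCliqueNumber (gasket G t) k → IsCliqueNumber (asGraph G) k)
        × (IsCliqueNumber (asGraph G) k → IsCliqueNumber (gasket G t) k)
mainTheorem1 (suc (suc _)) _ G (suc t) _ k =
  sameCliques⇒sameCliqueNumber S G′ (gasket⇒graph G t) (graph⇒gasket G zero t) k ,
  sameCliques⇒sameCliqueNumber G′ S (graph⇒gasket G zero t) (gasket⇒graph G t) k
  where
  S G′ : Graph
  S = gasket G (suc t)
  G′ = asGraph G
mainTheorem1 zero () G t _ k
mainTheorem1 (suc zero) (s≤s ()) G t _ k
mainTheorem1 (suc (suc _)) _ G zero () k
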